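{- Let $L$ be a finite distributive lattice such that every connected component of the poset $\mathcal{J}(L)$ of its join-irreducible elements has a single bottom element. Let $x\in L$ be complemented with complement $x'$, and let $\eta(t):=\{j\in\mathcal{J}(L)\mid j\leq t\}$. Define $\mathcal{D}_x(\mathcal{J}(L))$ as the set of maps $\xi:\mathcal{J}(L)\to\{ -1,0,1\}$ such that $|\xi|$ is nonincreasing, $\xi(j)\geq0$ for $j\in\eta(x)$ and $\xi(j)\leq0$ for $j\in\eta(x')$; and $\mathcal{C}_x(\mathcal{J}(L))$ as the set of maps $f:\mathcal{J}(L)\to[-1,1]$ such that $|f|$ is nonincreasing, $f(j)\geq0$ for $j\in\eta(x)$ and $f(j)\leq0$ for $j\in\eta(x')$. Then $\mathcal{D}_x(\mathcal{J}(L))$ is exactly the set of vertices (extreme points) of $\mathcal{C}_x(\mathcal{J}(L))$, viewed as a subset of $\mathbb{R}^{\mathcal{J}(L)}$.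
   Context: A join-irreducible element of a finite lattice is an element covering exactly one element. $x$ is complemented if there is $x'$ with $x\wedge x'=\bot$ and $x\vee x'=\top$. "Nonincreasing" is with respect to the order of $L$ restricted to $\mathcal{J}(L)$: $j\leq j'$ implies $|\xi(j)|\geq|\xi(j')|$.
   Formalization: The ambient space $\mathbb{R}^{\mathcal{J}(L)}$ is replaced by its rational points, so the maps $f$ in $\mathcal{C}_x(\mathcal{J}(L))$ and the weights in the extreme-point test are rational. -}

module Defs where

open import Level using (Level; _⊔_)
open import Data.Nat using (ℕ)
open import Data.Fin using (Fin)
open import Data.Product using (Σ; ∃; _×_; _,_)
open import Data.Sum using (_⊎_)
open import Relation.Nullary using (¬_)
open import Relation.Binary.PropositionalEquality using (_≡_)
open import Relation.Binary.Lattice.Bundles using (DistributiveLattice)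
open import Data.Rational using (ℚ; 0ℚ; 1ℚ; -_; _+_; _*_; _-_; ∣_∣)
  renaming (_≤_ to _≤ℚ_; _<_ to _<ℚ_)

record IsFinite {c ℓ₁ ℓ₂ : Level} (L : DistributiveLattice c ℓ₁ ℓ₂) : Set (c ⊔ ℓ₁) where
  open DistributiveLattice L
  field
    size     : ℕ
    enum     : Fin size → Carrier
    complete : ∀ x → ∃ λ i → enum i ≈ x

module _ {c ℓ₁ ℓ₂ : Level} (L : DistributiveLattice c ℓ₁ ℓ₂) where
  open DistributiveLattice L

  _<L_ : Carrier → Carrier → Set (ℓ₁ ⊔ ℓ₂)
  a <L b = a ≤ b × ¬ (a ≈ b)

  Covers : Carrier → Carrier → Set (c ⊔ ℓ₁ ⊔ ℓ₂)
  Covers j y = y <L j × (∀ z → y <L z → ¬ (z <L j))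

  IsJoinIrr : Carrier → Set (c ⊔ ℓ₁ ⊔ ℓ₂)
  IsJoinIrr j = ∃ λ y → Covers j y × (∀ z → Covers j z → z ≈ y)

  -- connectedness in the comparability graph of the poset J(L)
  data Connected : Carrier → Carrier → Set (c ⊔ ℓ₁ ⊔ ℓ₂) where
    conn-refl : ∀ {j} → Connected j j
    conn-step : ∀ {j k l} → IsJoinIrr k → (j ≤ k ⊎ k ≤ j) → Connected k l → Connected j l

  ComponentsHaveBottom : Set (c ⊔ ℓ₁ ⊔ ℓ₂)
  ComponentsHaveBottom =
    ∀ j → IsJoinIrr j →
      ∃ λ b → IsJoinIrr b × Connected j b ×
        (∀ k → IsJoinIrr k → Connected j k → b ≤ k)

  IsComplement : Carrier → Carrier → Set (c ⊔ ℓ₂)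
  IsComplement x x' = (∀ y → (x ∧ x') ≤ y) × (∀ y → y ≤ (x ∨ x'))

  -- points of ℚ^{J(L)}: functions on the carrier, respecting ≈, only their
  -- values on J(L) matter
  Respects : (Carrier → ℚ) → Set (c ⊔ ℓ₁)
  Respects f = ∀ a b → a ≈ b → f a ≡ f b

  _≐J_ : (Carrier → ℚ) → (Carrier → ℚ) → Set (c ⊔ ℓ₁ ⊔ ℓ₂)
  f ≐J g = ∀ j → IsJoinIrr j → f j ≡ g j

  AbsNonincreasing : (Carrier → ℚ) → Set (c ⊔ ℓ₁ ⊔ ℓ₂)
  AbsNonincreasing f =
    ∀ j j' → IsJoinIrr j → IsJoinIrr j' → j ≤ j' → ∣ f j' ∣ ≤ℚ ∣ f j ∣

  SignConditions : Carrier → Carrier → (Carrier → ℚ) → Set (c ⊔ ℓ₁ ⊔ ℓ₂)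
  SignConditions x x' f =
    (∀ j → IsJoinIrr j → j ≤ x → 0ℚ ≤ℚ f j) ×
    (∀ j → IsJoinIrr j → j ≤ x' → f j ≤ℚ 0ℚ)

  Dx : Carrier → Carrier → (Carrier → ℚ) → Set (c ⊔ ℓ₁ ⊔ ℓ₂)
  Dx x x' ξ =
    Respects ξ ×
    (∀ j → IsJoinIrr j → ξ j ≡ - 1ℚ ⊎ ξ j ≡ 0ℚ ⊎ ξ j ≡ 1ℚ) ×
    AbsNonincreasing ξ × SignConditions x x' ξ

  Cx : Carrier → Carrier → (Carrier → ℚ) → Set (c ⊔ ℓ₁ ⊔ ℓ₂)
  Cx x x' f =
    Respects f ×
    (∀ j → IsJoinIrr j → (- 1ℚ ≤ℚ f j) × (f j ≤ℚ 1ℚ)) ×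
    AbsNonincreasing f × SignConditions x x' f

  IsExtremePoint : ((Carrier → ℚ) → Set (c ⊔ ℓ₁ ⊔ ℓ₂)) → (Carrier → ℚ) → Set (c ⊔ ℓ₁ ⊔ ℓ₂)
  IsExtremePoint S p =
    S p ×
    (∀ a b t → S a → S b → 0ℚ <ℚ t → t <ℚ 1ℚ →
      (∀ j → IsJoinIrr j → p j ≡ t * a j + (1ℚ - t) * b j) →
      (a ≐J p) × (b ≐J p))

-- If ξ ∈ 𝒟_x and ξ = t a + (1 - t) b with a, b ∈ 𝒞_x and 0 < t < 1, then ξ j is an
-- endpoint of an interval containing a j and b j, so a j = b j = ξ j: for ξ j = ±1
-- the interval is [-1, 1]; for ξ j = 0 it is [0, 1] or [-1, 0], because a
-- join-irreducible j of a finite distributive lattice is join-prime, so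
-- j ≤ x ∨ x' = ⊤ gives j ≤ x or j ≤ x'.
-- Conversely, 2s = ψ₊ s + ψ₋ s for ψ₊ s = min (1, 2s) and ψ₋ s = max (0, 2s - 1)
-- (stretchLower and stretchUpper).  Both are monotone and fix 0, so applying them
-- to |f| while keeping the sign of f stays inside 𝒞_x, and f is the midpoint of
-- the two results.  If f is extreme then ψ₊ |f j| = |f j|, i.e. |f j| ∈ {0, 1}.
module Submission where

open import Defs
open import Level using (Level) renaming (_⊔_ to _⊔ˡ_)
open import Data.Nat using (zero; suc)
open import Data.Fin using (Fin; zero; suc)
open import Data.Product using (_×_; _,_; proj₁; proj₂; ∃; map)
open import Data.Sum using (_⊎_; inj₁; inj₂)
open import Function using (_∘_)
open import Relation.Binary using (Poset; _Preserves_⟶_)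
open import Relation.Binary.Lattice.Bundles using (DistributiveLattice)
open import Relation.Binary.PropositionalEquality
  using (_≡_; refl; sym; trans; cong; cong₂; subst; subst₂; module ≡-Reasoning)
open import Data.Empty using (⊥)
open import Relation.Nullary using (¬_; yes; no)
open import Relation.Nullary.Decidable using (decidable-stable; _×-dec_; from-yes)
open import Relation.Nullary.Negation using (¬¬-map; contradiction)
open import Data.Rational
  using (ℚ; 0ℚ; 1ℚ; ½; -_; _+_; _*_; _-_; ∣_∣; _⊓_; _⊔_; positive; nonNegative)
  renaming (_≤_ to _≤ℚ_; _<_ to _<ℚ_)
open import Data.Rational.Properties
  using (_≟_; _≤?_; _<?_; ≤-refl; ≤-reflexive; ≤-trans; ≤-antisym; ≤-total;
         <⇒≤; ≮⇒≥; ≰⇒>; <-irrefl;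
         +-comm; +-assoc; +-inverseʳ; +-mono-≤; +-monoˡ-≤; +-monoˡ-<; +-mono-<-≤;
         *-monoʳ-<-pos; *-monoˡ-≤-nonNeg; neg-antimono-≤; neg-injective; neg-distrib-+;
         0≤p⇒∣p∣≡p; ∣-p∣≡∣p∣; ∣p∣≡p∨∣p∣≡-p; ∣p∣≡0⇒p≡0;
         p≤q⇒p⊓q≡p; p≥q⇒p⊓q≡q; p≤q⇒p⊔q≡q; p≥q⇒p⊔q≡p;
         ⊓-sel; ⊓-monoʳ-≤; ⊔-monoʳ-≤)
open import Data.Rational.Solver using (module +-*-Solver)
open +-*-Solver using (solve; _:+_; _:*_; _:-_; :-_; con; _:=_)

convex-comb-< : ∀ {s r p q u} → 0ℚ <ℚ s → 0ℚ ≤ℚ r → p <ℚ u → q ≤ℚ u →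
                s * p + r * q <ℚ s * u + r * u
convex-comb-< {s} {r} 0<s 0≤r p<u q≤u =
  +-mono-<-≤ (*-monoʳ-<-pos s {{positive 0<s}} p<u) (*-monoˡ-≤-nonNeg r {{nonNegative 0≤r}} q≤u)

convex-comb-at-upper-bound : ∀ {t p q u} → 0ℚ <ℚ t → t <ℚ 1ℚ → p ≤ℚ u → q ≤ℚ u →
                             t * p + (1ℚ - t) * q ≡ u → p ≡ u × q ≡ u
convex-comb-at-upper-bound {t} {p} {q} {u} 0<t t<1 p≤u q≤u comb≡u =
  ≤-antisym p≤u (≮⇒≥ p≮u) , ≤-antisym q≤u (≮⇒≥ q≮u)
  where
  0<1-t : 0ℚ <ℚ 1ℚ - t
  0<1-t = subst (_<ℚ 1ℚ - t) (+-inverseʳ t) (+-monoˡ-< (- t) t<1)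
  comb≮u : ¬ (t * p + (1ℚ - t) * q <ℚ t * u + (1ℚ - t) * u)
  comb≮u = <-irrefl (trans comb≡u (solve 2 (λ t u → u := t :* u :+ (con 1ℚ :- t) :* u) refl t u))
  p≮u : ¬ p <ℚ u
  p≮u p<u = comb≮u (convex-comb-< 0<t (<⇒≤ 0<1-t) p<u q≤u)
  q≮u : ¬ q <ℚ u
  q≮u q<u = comb≮u (subst₂ _<ℚ_ (+-comm ((1ℚ - t) * q) (t * p)) (+-comm ((1ℚ - t) * u) (t * u))
                      (convex-comb-< 0<1-t (<⇒≤ 0<t) q<u p≤u))

convex-comb-neg : ∀ t p q → t * - p + (1ℚ - t) * - q ≡ - (t * p + (1ℚ - t) * q)
convex-comb-neg = solve 3 (λ t p q → t :* (:- p) :+ (con 1ℚ :- t) :* (:- q)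
                                   := :- (t :* p :+ (con 1ℚ :- t) :* q)) refl

convex-comb-at-lower-bound : ∀ {t p q u} → 0ℚ <ℚ t → t <ℚ 1ℚ → u ≤ℚ p → u ≤ℚ q →
                             t * p + (1ℚ - t) * q ≡ u → p ≡ u × q ≡ u
convex-comb-at-lower-bound {t} {p} {q} 0<t t<1 u≤p u≤q comb≡u =
  map neg-injective neg-injective
    (convex-comb-at-upper-bound 0<t t<1 (neg-antimono-≤ u≤p) (neg-antimono-≤ u≤q)
      (trans (convex-comb-neg t p q) (cong -_ comb≡u)))

convex-comb-at-bound : ∀ {t p q u} → 0ℚ <ℚ t → t <ℚ 1ℚ →
                       (p ≤ℚ u × q ≤ℚ u) ⊎ (u ≤ℚ p × u ≤ℚ q) →
                       t * p + (1ℚ - t) * q ≡ u → p ≡ u × q ≡ u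
convex-comb-at-bound 0<t t<1 (inj₁ (p≤u , q≤u)) = convex-comb-at-upper-bound 0<t t<1 p≤u q≤u
convex-comb-at-bound 0<t t<1 (inj₂ (u≤p , u≤q)) = convex-comb-at-lower-bound 0<t t<1 u≤p u≤q

midpoint : ∀ {a b q} → a + b ≡ q + q → q ≡ ½ * a + (1ℚ - ½) * b
midpoint {a} {b} {q} a+b≡2q = begin
  q                      ≡⟨ solve 1 (λ q → q := con ½ :* (q :+ q)) refl q ⟩
  ½ * (q + q)            ≡⟨ cong (½ *_) a+b≡2q ⟨
  ½ * (a + b)            ≡⟨ solve 2 (λ a b → con ½ :* (a :+ b)
                                            := con ½ :* a :+ (con 1ℚ :- con ½) :* b) refl a b ⟩
  ½ * a + (1ℚ - ½) * b   ∎
  where open ≡-Reasoning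

Ternary : ℚ → Set
Ternary q = q ≡ - 1ℚ ⊎ q ≡ 0ℚ ⊎ q ≡ 1ℚ

-1≤0 : - 1ℚ ≤ℚ 0ℚ
-1≤0 = from-yes (- 1ℚ ≤? 0ℚ)

0≤1 : 0ℚ ≤ℚ 1ℚ
0≤1 = from-yes (0ℚ ≤? 1ℚ)

-1≤1 : - 1ℚ ≤ℚ 1ℚ
-1≤1 = ≤-trans -1≤0 0≤1

Ternary⇒bounds : ∀ {q} → Ternary q → - 1ℚ ≤ℚ q × q ≤ℚ 1ℚ
Ternary⇒bounds (inj₁ refl)        = ≤-refl , -1≤1
Ternary⇒bounds (inj₂ (inj₁ refl)) = -1≤0 , 0≤1
Ternary⇒bounds (inj₂ (inj₂ refl)) = -1≤1 , ≤-refl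

∣∣∈01⇒Ternary : ∀ {q} → ∣ q ∣ ≡ 0ℚ ⊎ ∣ q ∣ ≡ 1ℚ → Ternary q
∣∣∈01⇒Ternary {q} (inj₁ ∣q∣≡0) = inj₂ (inj₁ (∣p∣≡0⇒p≡0 q ∣q∣≡0))
∣∣∈01⇒Ternary {q} (inj₂ ∣q∣≡1) with ∣p∣≡p∨∣p∣≡-p q
... | inj₁ ∣q∣≡q  = inj₂ (inj₂ (trans (sym ∣q∣≡q) ∣q∣≡1))
... | inj₂ ∣q∣≡-q = inj₁ (neg-injective (trans (sym ∣q∣≡-q) ∣q∣≡1))

0≰q⇒0≤-q : ∀ {q} → ¬ 0ℚ ≤ℚ q → 0ℚ ≤ℚ - q
0≰q⇒0≤-q 0≰q = neg-antimono-≤ (<⇒≤ (≰⇒> 0≰q))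

odd : (ℚ → ℚ) → ℚ → ℚ
odd ψ q with 0ℚ ≤? q
... | yes _ = ψ q
... | no  _ = - ψ (- q)

module _ {ψ : ℚ → ℚ} (ψ-mono : ψ Preserves _≤ℚ_ ⟶ _≤ℚ_) (ψ-0 : ψ 0ℚ ≡ 0ℚ) where
  open ≡-Reasoning

  ψ-nonneg : ∀ {s} → 0ℚ ≤ℚ s → 0ℚ ≤ℚ ψ s
  ψ-nonneg 0≤s = subst (_≤ℚ ψ _) ψ-0 (ψ-mono 0≤s)

  ∣odd∣ : ∀ q → ∣ odd ψ q ∣ ≡ ψ ∣ q ∣
  ∣odd∣ q with 0ℚ ≤? q
  ... | yes 0≤q = begin
    ∣ ψ q ∣    ≡⟨ 0≤p⇒∣p∣≡p (ψ-nonneg 0≤q) ⟩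
    ψ q        ≡⟨ cong ψ (0≤p⇒∣p∣≡p 0≤q) ⟨
    ψ ∣ q ∣    ∎
  ... | no 0≰q = begin
    ∣ - ψ (- q) ∣  ≡⟨ ∣-p∣≡∣p∣ (ψ (- q)) ⟩
    ∣ ψ (- q) ∣    ≡⟨ 0≤p⇒∣p∣≡p (ψ-nonneg 0≤-q) ⟩
    ψ (- q)        ≡⟨ cong ψ (0≤p⇒∣p∣≡p 0≤-q) ⟨
    ψ ∣ - q ∣      ≡⟨ cong ψ (∣-p∣≡∣p∣ q) ⟩
    ψ ∣ q ∣        ∎
    where
    0≤-q : 0ℚ ≤ℚ - q
    0≤-q = 0≰q⇒0≤-q 0≰q

  odd-nonneg : ∀ {q} → 0ℚ ≤ℚ q → 0ℚ ≤ℚ odd ψ q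
  odd-nonneg {q} 0≤q with 0ℚ ≤? q
  ... | yes _   = ψ-nonneg 0≤q
  ... | no 0≰q = contradiction 0≤q 0≰q

  odd-nonpos : ∀ {q} → q ≤ℚ 0ℚ → odd ψ q ≤ℚ 0ℚ
  odd-nonpos {q} q≤0 with 0ℚ ≤? q
  ... | yes 0≤q = ≤-reflexive (trans (cong ψ (≤-antisym q≤0 0≤q)) ψ-0)
  ... | no 0≰q  = neg-antimono-≤ (ψ-nonneg (neg-antimono-≤ q≤0))

  odd-bounds : ψ 1ℚ ≤ℚ 1ℚ → ∀ {q} → - 1ℚ ≤ℚ q × q ≤ℚ 1ℚ →
               - 1ℚ ≤ℚ odd ψ q × odd ψ q ≤ℚ 1ℚ
  odd-bounds ψ-1 {q} (-1≤q , q≤1) with 0ℚ ≤? q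
  ... | yes 0≤q = ≤-trans -1≤0 (ψ-nonneg 0≤q) , ≤-trans (ψ-mono q≤1) ψ-1
  ... | no 0≰q  = neg-antimono-≤ (≤-trans (ψ-mono (neg-antimono-≤ -1≤q)) ψ-1)
                , ≤-trans (neg-antimono-≤ (ψ-nonneg (0≰q⇒0≤-q 0≰q))) 0≤1

  ∣odd∣-mono : ∀ {q q'} → ∣ q ∣ ≤ℚ ∣ q' ∣ → ∣ odd ψ q ∣ ≤ℚ ∣ odd ψ q' ∣
  ∣odd∣-mono {q} {q'} ∣q∣≤∣q'∣ =
    subst₂ _≤ℚ_ (sym (∣odd∣ q)) (sym (∣odd∣ q')) (ψ-mono ∣q∣≤∣q'∣)

  odd-fixed⇒∣∣-fixed : ∀ {q} → odd ψ q ≡ q → ψ ∣ q ∣ ≡ ∣ q ∣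
  odd-fixed⇒∣∣-fixed {q} ψq≡q = trans (sym (∣odd∣ q)) (cong ∣_∣ ψq≡q)

odd-+ : ∀ {ψ₁ ψ₂} → (∀ s → ψ₁ s + ψ₂ s ≡ s + s) → ∀ q → odd ψ₁ q + odd ψ₂ q ≡ q + q
odd-+ {ψ₁} {ψ₂} sum q with 0ℚ ≤? q
... | yes _ = sum q
... | no  _ = begin
  - ψ₁ (- q) + - ψ₂ (- q)   ≡⟨ neg-distrib-+ (ψ₁ (- q)) (ψ₂ (- q)) ⟨
  - (ψ₁ (- q) + ψ₂ (- q))   ≡⟨ cong -_ (sum (- q)) ⟩
  - (- q + - q)             ≡⟨ solve 1 (λ q → :- (:- q :+ :- q) := q :+ q) refl q ⟩
  q + q                     ∎
  where open ≡-Reasoning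

stretchLower : ℚ → ℚ
stretchLower s = 1ℚ ⊓ (s + s)

stretchUpper : ℚ → ℚ
stretchUpper s = 1ℚ ⊔ (s + s) - 1ℚ

double-mono : ∀ {s s'} → s ≤ℚ s' → s + s ≤ℚ s' + s'
double-mono s≤s' = +-mono-≤ s≤s' s≤s'

stretchLower-mono : stretchLower Preserves _≤ℚ_ ⟶ _≤ℚ_
stretchLower-mono = ⊓-monoʳ-≤ 1ℚ ∘ double-mono

stretchUpper-mono : stretchUpper Preserves _≤ℚ_ ⟶ _≤ℚ_
stretchUpper-mono = +-monoˡ-≤ (- 1ℚ) ∘ ⊔-monoʳ-≤ 1ℚ ∘ double-mono

⊓+⊔≡+ : ∀ p q → p ⊓ q + (p ⊔ q) ≡ p + q
⊓+⊔≡+ p q with ≤-total p q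
... | inj₁ p≤q = cong₂ _+_ {p ⊓ q} {p} {p ⊔ q} {q} (p≤q⇒p⊓q≡p p≤q) (p≤q⇒p⊔q≡q p≤q)
... | inj₂ q≤p = trans (cong₂ _+_ {p ⊓ q} {q} {p ⊔ q} {p} (p≥q⇒p⊓q≡q q≤p) (p≥q⇒p⊔q≡p q≤p))
                       (+-comm q p)

stretch-+ : ∀ s → stretchLower s + stretchUpper s ≡ s + s
stretch-+ s = begin
  1ℚ ⊓ (s + s) + (1ℚ ⊔ (s + s) - 1ℚ)   ≡⟨ +-assoc (1ℚ ⊓ (s + s)) (1ℚ ⊔ (s + s)) (- 1ℚ) ⟨
  1ℚ ⊓ (s + s) + (1ℚ ⊔ (s + s)) - 1ℚ   ≡⟨ cong (_- 1ℚ) (⊓+⊔≡+ 1ℚ (s + s)) ⟩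
  1ℚ + (s + s) - 1ℚ                    ≡⟨ solve 1 (λ s → con 1ℚ :+ (s :+ s) :- con 1ℚ := s :+ s) refl s ⟩
  s + s                                ∎
  where open ≡-Reasoning

stretchLower-fixed : ∀ {s} → stretchLower s ≡ s → s ≡ 0ℚ ⊎ s ≡ 1ℚ
stretchLower-fixed {s} fixed with ⊓-sel 1ℚ (s + s)
... | inj₁ min≡1  = inj₂ (trans (sym fixed) min≡1)
... | inj₂ min≡2s = inj₁ (begin
  s               ≡⟨ solve 1 (λ s → s := (s :+ s) :- s) refl s ⟩
  (s + s) - s     ≡⟨ cong (_- s) (trans (sym min≡2s) fixed) ⟩
  s - s           ≡⟨ +-inverseʳ s ⟩
  0ℚ              ∎)
  where open ≡-Reasoning

module _ {c ℓ₁ ℓ₂ : Level} (P : Poset c ℓ₁ ℓ₂) where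
  open Poset P using (Carrier; _≈_; _≤_; antisym; ≤-respˡ-≈)
  module P = Poset P
  open import Relation.Binary.Properties.Poset P using (_<_)
  open import Relation.Binary.Construct.NonStrictToStrict _≈_ _≤_ using (≤-<-trans)

  ¬¬-maximal-above : ∀ {p} (Q : Carrier → Set p) {n} (g : Fin n → Carrier) {z} → Q z →
    ¬ ¬ (∃ λ m → Q m × z ≤ m × ∀ i → Q (g i) → ¬ (m < g i))
  ¬¬-maximal-above Q {zero} g {z} Qz k = k (z , Qz , P.refl , λ ())
  ¬¬-maximal-above Q {suc n} g {z} Qz k = skip-head (λ take → take-head take)
    where
    skip-head : ¬ (Q (g zero) × z < g zero) → ⊥
    skip-head ¬take = ¬¬-maximal-above Q (g ∘ suc) Qz λ where
      (m , Qm , z≤m , maximal) → k (m , Qm , z≤m , λ where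
        zero Qg m<g → ¬take (Qg , ≤-<-trans P.trans antisym ≤-respˡ-≈ z≤m m<g)
        (suc i)      → maximal i)
    take-head : Q (g zero) × z < g zero → ⊥
    take-head (Qg , z<g) = ¬¬-maximal-above Q (g ∘ suc) Qg λ where
      (m , Qm , g≤m , maximal) → k (m , Qm , P.trans (proj₁ z<g) g≤m , λ where
        zero _ (m≤g , m≉g) → m≉g (antisym m≤g g≤m)
        (suc i)            → maximal i)

module _ {c ℓ₁ ℓ₂ : Level} (L : DistributiveLattice c ℓ₁ ℓ₂) where
  open DistributiveLattice L using (Carrier; _≈_; _≤_; _∧_; _∨_; poset; module Eq;
    reflexive; antisym; x∧y≤x; x∧y≤y; ∧-greatest; ∨-least; ∧-distribˡ-∨)
  module DL = DistributiveLattice L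
  open import Relation.Binary.Properties.Poset poset using (<-respˡ-≈; <-respʳ-≈)

  infix 4 _<_
  _<_ : Carrier → Carrier → Set (ℓ₁ ⊔ˡ ℓ₂)
  _<_ = _<L_ L

  below-unique-lower-cover : IsFinite L → ∀ {j y} → (∀ w → Covers L j w → w ≈ y) →
                             ∀ {z} → z < j → ¬ ¬ (z ≤ y)
  below-unique-lower-cover fin {j} {y} unique {z} z<j =
    ¬¬-map z≤y (¬¬-maximal-above poset between enum (DL.refl , z<j))
    where
    open IsFinite fin
    between : Carrier → Set (ℓ₁ ⊔ˡ ℓ₂)
    between w = z ≤ w × w < j
    z≤y : (∃ λ m → between m × z ≤ m × ∀ i → between (enum i) → ¬ m < enum i) → z ≤ y
    z≤y (m , (z≤m , m<j) , _ , maximal) =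
      DL.trans z≤m (reflexive (unique m (m<j , nothing-between)))
      where
      nothing-between : ∀ w → m < w → ¬ w < j
      nothing-between w m<w w<j with complete w
      ... | i , eᵢ≈w =
        maximal i (DL.trans z≤m (proj₁ m<eᵢ) , <-respˡ-≈ (Eq.sym eᵢ≈w) w<j) m<eᵢ
        where
        m<eᵢ : m < enum i
        m<eᵢ = <-respʳ-≈ (Eq.sym eᵢ≈w) m<w

  joinIrr-prime : IsFinite L → ∀ {j a b} → IsJoinIrr L j → j ≤ a ∨ b → ¬ ¬ (j ≤ a ⊎ j ≤ b)
  joinIrr-prime fin {j} {a} {b} (y , ((y≤j , y≉j) , _) , unique) j≤a∨b j≰a⊎b =
    below (meet-< (j≰a⊎b ∘ inj₁)) λ j∧a≤y →
    below (meet-< (j≰a⊎b ∘ inj₂)) λ j∧b≤y →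
    y≉j (antisym y≤j (DL.trans (∧-greatest DL.refl j≤a∨b)
                     (DL.trans (reflexive (∧-distribˡ-∨ j a b)) (∨-least j∧a≤y j∧b≤y))))
    where
    below : ∀ {z} → z < j → ¬ ¬ (z ≤ y)
    below = below-unique-lower-cover fin unique
    meet-< : ∀ {d} → ¬ (j ≤ d) → j ∧ d < j
    meet-< {d} j≰d =
      x∧y≤x j d , λ j∧d≈j → j≰d (DL.trans (reflexive (Eq.sym j∧d≈j)) (x∧y≤y j d))

  Dx⇒Cx : ∀ {x x' f} → Dx L x x' f → Cx L x x' f
  Dx⇒Cx (resp , ternary , nonincr , signs) =
    resp , (λ j jIrr → Ternary⇒bounds (ternary j jIrr)) , nonincr , signs

  Cx-odd-∘ : ∀ {x x' f ψ} → ψ Preserves _≤ℚ_ ⟶ _≤ℚ_ → ψ 0ℚ ≡ 0ℚ → ψ 1ℚ ≤ℚ 1ℚ →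
             Cx L x x' f → Cx L x x' (odd ψ ∘ f)
  Cx-odd-∘ {ψ = ψ} ψ-mono ψ-0 ψ-1 (resp , bounds , nonincr , nonneg , nonpos) =
      (λ a b a≈b → cong (odd ψ) (resp a b a≈b))
    , (λ j jIrr → odd-bounds ψ-mono ψ-0 ψ-1 (bounds j jIrr))
    , (λ j j' jIrr j'Irr j≤j' → ∣odd∣-mono ψ-mono ψ-0 (nonincr j j' jIrr j'Irr j≤j'))
    , (λ j jIrr j≤x → odd-nonneg ψ-mono ψ-0 (nonneg j jIrr j≤x))
    , (λ j jIrr j≤x' → odd-nonpos ψ-mono ψ-0 (nonpos j jIrr j≤x'))

  Dx⇒IsExtremePoint : IsFinite L → ∀ {x x' f} → (∀ y → y ≤ x ∨ x') →
                      Dx L x x' f → IsExtremePoint L (Cx L x x') f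
  Dx⇒IsExtremePoint fin {x} {x'} {f} ≤x∨x' D@(_ , ternary , _) = Dx⇒Cx D , extreme
    where
    extreme : ∀ a b t → Cx L x x' a → Cx L x x' b → 0ℚ <ℚ t → t <ℚ 1ℚ →
              (∀ j → IsJoinIrr L j → f j ≡ t * a j + (1ℚ - t) * b j) →
              _≐J_ L a f × _≐J_ L b f
    extreme a b t (_ , a-bounds , _ , a-nonneg , a-nonpos) (_ , b-bounds , _ , b-nonneg , b-nonpos)
            0<t t<1 f≡comb =
      (λ j jIrr → proj₁ (at j jIrr)) , (λ j jIrr → proj₂ (at j jIrr))
      where
      same-side : ∀ j → IsJoinIrr L j →
                  ¬ ¬ ((a j ≤ℚ f j × b j ≤ℚ f j) ⊎ (f j ≤ℚ a j × f j ≤ℚ b j))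
      same-side j jIrr with f j | ternary j jIrr
      ... | _ | inj₁ refl        = λ k → k (inj₂ (proj₁ (a-bounds j jIrr) , proj₁ (b-bounds j jIrr)))
      ... | _ | inj₂ (inj₂ refl) = λ k → k (inj₁ (proj₂ (a-bounds j jIrr) , proj₂ (b-bounds j jIrr)))
      ... | _ | inj₂ (inj₁ refl) = ¬¬-map side (joinIrr-prime fin jIrr (≤x∨x' j))
        where
        side : j ≤ x ⊎ j ≤ x' → (a j ≤ℚ 0ℚ × b j ≤ℚ 0ℚ) ⊎ (0ℚ ≤ℚ a j × 0ℚ ≤ℚ b j)
        side (inj₁ j≤x)  = inj₂ (a-nonneg j jIrr j≤x , b-nonneg j jIrr j≤x)
        side (inj₂ j≤x') = inj₁ (a-nonpos j jIrr j≤x' , b-nonpos j jIrr j≤x')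
      -- ℚ has decidable equality, which discharges the double negation coming from joinIrr-prime.
      at : ∀ j → IsJoinIrr L j → a j ≡ f j × b j ≡ f j
      at j jIrr = decidable-stable ((a j ≟ f j) ×-dec (b j ≟ f j))
        (¬¬-map (λ side → convex-comb-at-bound 0<t t<1 side (sym (f≡comb j jIrr))) (same-side j jIrr))

  IsExtremePoint⇒Dx : ∀ {x x' f} → IsExtremePoint L (Cx L x x') f → Dx L x x' f
  IsExtremePoint⇒Dx {f = f} (C@(resp , _ , nonincr , signs) , extreme) = resp , ternary , nonincr , signs
    where
    f₊≐f : _≐J_ L (odd stretchLower ∘ f) f
    f₊≐f = proj₁ (extreme (odd stretchLower ∘ f) (odd stretchUpper ∘ f) ½
      (Cx-odd-∘ stretchLower-mono refl ≤-refl C) (Cx-odd-∘ stretchUpper-mono refl ≤-refl C)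
      (from-yes (0ℚ <? ½)) (from-yes (½ <? 1ℚ))
      (λ j _ → midpoint {odd stretchLower (f j)} {odd stretchUpper (f j)}
                 (odd-+ {stretchLower} {stretchUpper} stretch-+ (f j))))
    ternary : ∀ j → IsJoinIrr L j → Ternary (f j)
    ternary j jIrr = ∣∣∈01⇒Ternary (stretchLower-fixed
      (odd-fixed⇒∣∣-fixed stretchLower-mono refl (f₊≐f j jIrr)))

mainTheorem5 : {c ℓ₁ ℓ₂ : Level} (L : DistributiveLattice c ℓ₁ ℓ₂) →
    IsFinite L → ComponentsHaveBottom L →
    (x x' : DistributiveLattice.Carrier L) → IsComplement L x x' →
    (f : DistributiveLattice.Carrier L → ℚ) →
    (Dx L x x' f → IsExtremePoint L (Cx L x x') f) ×
    (IsExtremePoint L (Cx L x x') f → Dx L x x' f)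
mainTheorem5 L fin _ x x' (_ , ≤x∨x') f = Dx⇒IsExtremePoint L fin ≤x∨x' , IsExtremePoint⇒Dx L
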